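{- Let $N = q^k n^2$ be an odd perfect number given in Eulerian form, and let $H = \gcd(n^2,\sigma(n^2))$. If $H$ is squarefree, then $\sigma(q^k)/2$ is not squarefree.
   Context: $\sigma(x)$ denotes the sum of the positive divisors of $x$. A positive integer $N$ is perfect if $\sigma(N)=2N$. An odd perfect number $N$ is said to be given in Eulerian form $N = q^k n^2$ if $q$ is a prime (the special prime), $k$ and $n$ are positive integers, $q \equiv k \equiv 1 \pmod 4$, and $\gcd(q,n)=1$. -}

module Defs where

open import Data.Nat using (ℕ; suc; _*_)
open import Data.Nat.Divisibility using (_∣_; _∣?_)
open import Data.List using (List; filter; upTo; map)
open import Data.Nat.ListAction using (sum)
open import Relation.Binary.PropositionalEquality using (_≡_)

σ : ℕ → ℕ
σ x = sum (filter (λ d → d ∣? x) (map suc (upTo x)))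

Perfect : ℕ → Set
Perfect N = σ N ≡ 2 * N

Squarefree : ℕ → Set
Squarefree m = ∀ d → d * d ∣ m → d ≡ 1

-- Since q ≡ k ≡ 1 (mod 4), σ(q^k) ≡ k + 1 ≡ 2 (mod 4), so s = σ(q^k)/2 is an integer coprime to q, and
-- σ(q^k) σ(n²) = 2 q^k n² becomes s σ(n²) = q^k n². Hence n² = s t and σ(n²) = q^k t with t = H. If s and H
-- are both squarefree, n² = s H forces s = H = n: n is squarefree, σ(n²) = q^k n and σ(q^k) = 2n.
-- For squarefree n, σ(n²) is the product of the p² + p + 1 over the primes p ∣ n, and by Fermat every
-- prime divisor of x² + x + 1 is 3 or ≡ 1 (mod 3). As 3 ∤ q^k, counting factors of 3 on both sides of
-- σ(n²) = q^k n leaves only n = 1 and (n, q^k) = (39, 61), and neither satisfies σ(q^k) = 2n.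
module Submission where

open import Defs
open import Data.Nat using (ℕ; _*_; _^_; _%_; _/_; _<_)
open import Data.Nat.Divisibility using (_∣_)
open import Data.Nat.Primality using (Prime)
open import Data.Nat.GCD using (gcd)
open import Relation.Binary.PropositionalEquality using (_≡_)
open import Relation.Nullary using (¬_)

open import Data.List using ([]; _∷_; filter; applyUpTo)
open import Data.List.Properties using (map-applyUpTo)
open import Data.List.Relation.Unary.All using (_∷_)
open import Data.Nat
open import Data.Nat.Combinatorics using (_C_; nCn≡1; nCk+nC[k+1]≡[n+1]C[k+1]; k>n⇒nCk≡0; nCk≡n!/k![n-k]!; k![n∸k]!∣n!)
open import Data.Nat.Coprimality using (Coprime; coprime-divisor; coprime-/gcd; coprime⇒gcd≡1)
open import Data.Nat.Divisibility
open import Data.Nat.DivMod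
open import Data.Nat.GCD
open import Data.Nat.Induction using (<-rec)
open import Data.Nat.ListAction using (sum; product)
open import Data.Nat.Primality
open import Data.Nat.Primality.Factorisation using (PrimeFactorisation; factorise)
open import Data.Nat.Properties
open import Data.Nat.Tactic.RingSolver using (solve-∀)
open import Data.Product using (∃-syntax; _×_; _,_; proj₁; proj₂; map₁)
open import Data.Sum using (_⊎_; inj₁; inj₂; [_,_]′)
open import Function using (_∘_; id)
open import Relation.Binary.PropositionalEquality
open import Relation.Nullary using (¬_; contradiction; Dec; yes; no)
open import Relation.Nullary.Decidable using (from-yes; from-no)
open import Relation.Unary using (Pred; Decidable)
open import Algebra.Properties.CommutativeSemigroup +-commutativeSemigroup using (interchange)
open import Algebra.Properties.CommutativeSemigroup *-commutativeSemigroup using (x∙yz≈y∙xz)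

-- Finite sums

∑ : ℕ → (ℕ → ℕ) → ℕ
∑ zero    f = 0
∑ (suc n) f = ∑ n f + f n

∑-cong : ∀ n {f g} → (∀ i → i < n → f i ≡ g i) → ∑ n f ≡ ∑ n g
∑-cong zero    eq = refl
∑-cong (suc n) eq = cong₂ _+_ (∑-cong n (λ i i<n → eq i (m<n⇒m<1+n i<n))) (eq n ≤-refl)

∑-zero : ∀ n {f} → (∀ i → i < n → f i ≡ 0) → ∑ n f ≡ 0
∑-zero zero    eq = refl
∑-zero (suc n) eq = cong₂ _+_ (∑-zero n (λ i i<n → eq i (m<n⇒m<1+n i<n))) (eq n ≤-refl)

∑-distrib-+ : ∀ n f g → ∑ n (λ i → f i + g i) ≡ ∑ n f + ∑ n g
∑-distrib-+ zero    f g = refl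
∑-distrib-+ (suc n) f g =
  trans (cong (_+ (f n + g n)) (∑-distrib-+ n f g)) (interchange (∑ n f) (∑ n g) (f n) (g n))

∑-distribˡ-* : ∀ n c f → ∑ n (λ i → c * f i) ≡ c * ∑ n f
∑-distribˡ-* zero    c f = sym (*-zeroʳ c)
∑-distribˡ-* (suc n) c f =
  trans (cong (_+ c * f n) (∑-distribˡ-* n c f)) (sym (*-distribˡ-+ c (∑ n f) (f n)))

∑-split : ∀ m n f → ∑ (m + n) f ≡ ∑ m f + ∑ n (λ i → f (m + i))
∑-split m zero    f = trans (cong (λ k → ∑ k f) (+-identityʳ m)) (sym (+-identityʳ (∑ m f)))
∑-split m (suc n) f = begin
  ∑ (m + suc n) f                               ≡⟨ cong (λ k → ∑ k f) (+-suc m n) ⟩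
  ∑ (m + n) f + f (m + n)                       ≡⟨ cong (_+ f (m + n)) (∑-split m n f) ⟩
  ∑ m f + ∑ n (λ i → f (m + i)) + f (m + n)     ≡⟨ +-assoc (∑ m f) _ _ ⟩
  ∑ m f + ∑ (suc n) (λ i → f (m + i))           ∎
  where open ≡-Reasoning

∑-head : ∀ n f → ∑ (suc n) f ≡ f 0 + ∑ n (f ∘ suc)
∑-head n f = trans (∑-split 1 n f) (cong (_+ ∑ n (f ∘ suc)) (+-identityˡ (f 0)))

∣-∑ : ∀ n {d f} → (∀ i → i < n → d ∣ f i) → d ∣ ∑ n f
∣-∑ zero    {d} _   = d ∣0
∣-∑ (suc n)     div = ∣m∣n⇒∣m+n (∣-∑ n (λ i i<n → div i (m<n⇒m<1+n i<n))) (div n ≤-refl)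


-- Fermat's little theorem

prime>1 : ∀ {p} → Prime p → 1 < p
prime>1 {p} pr = nonTrivial⇒n>1 p {{prime⇒nonTrivial pr}}

prime∤1 : ∀ {p} → Prime p → ¬ p ∣ 1
prime∤1 pr p∣1 = <⇒≢ (prime>1 pr) (sym (∣1⇒≡1 p∣1))

prime[3] : Prime 3
prime[3] = from-yes (prime? 3)

binomial-theorem : ∀ a n → (1 + a) ^ n ≡ ∑ (suc n) (λ i → (n C i) * a ^ i)
binomial-theorem a zero    = refl
binomial-theorem a (suc n) = sym (begin
  ∑ (2 + n) (term (suc n))                                  ≡⟨ ∑-head (suc n) (term (suc n)) ⟩
  1 + ∑ (suc n) (term (suc n) ∘ suc)                        ≡⟨ cong (1 +_) (∑-cong (suc n) (λ i _ → pascal i)) ⟩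
  1 + ∑ (suc n) (λ i → a * term n i + term n (suc i))       ≡⟨ cong (1 +_) (∑-distrib-+ (suc n) _ _) ⟩
  1 + (∑ (suc n) (λ i → a * term n i) + ∑ (suc n) (term n ∘ suc))
    ≡⟨ cong (λ z → 1 + (z + ∑ (suc n) (term n ∘ suc))) (∑-distribˡ-* (suc n) a (term n)) ⟩
  1 + (a * X + ∑ (suc n) (term n ∘ suc))                    ≡⟨ sym (+-suc (a * X) _) ⟩
  a * X + (1 + ∑ (suc n) (term n ∘ suc))                    ≡⟨ cong (a * X +_) (sym (∑-head (suc n) (term n))) ⟩
  a * X + ∑ (2 + n) (term n)                                ≡⟨ cong (a * X +_) top-vanishes ⟩
  a * X + X                                                 ≡⟨ +-comm (a * X) X ⟩
  (1 + a) * X                                               ≡⟨ cong ((1 + a) *_) (sym (binomial-theorem a n)) ⟩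
  (1 + a) ^ suc n                                           ∎)
  where
  open ≡-Reasoning
  term : ℕ → ℕ → ℕ
  term m i = (m C i) * a ^ i
  X = ∑ (suc n) (term n)
  top-vanishes : ∑ (2 + n) (term n) ≡ X
  top-vanishes = trans (cong (λ c → X + c * a ^ suc n) (k>n⇒nCk≡0 {n} {suc n} (n<1+n n))) (+-identityʳ X)
  pascal : ∀ i → term (suc n) (suc i) ≡ a * term n i + term n (suc i)
  pascal i = begin
    (suc n C suc i) * (a * a ^ i)            ≡⟨ cong (_* (a * a ^ i)) (sym (nCk+nC[k+1]≡[n+1]C[k+1] n i)) ⟩
    ((n C i) + (n C suc i)) * (a * a ^ i)    ≡⟨ *-distribʳ-+ (a * a ^ i) (n C i) (n C suc i) ⟩
    (n C i) * (a * a ^ i) + term n (suc i)   ≡⟨ cong (_+ term n (suc i)) (x∙yz≈y∙xz (n C i) a (a ^ i)) ⟩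
    a * term n i + term n (suc i)            ∎

prime∤! : ∀ {p} → Prime p → ∀ m → m < p → ¬ p ∣ m !
prime∤! pr zero    _   = prime∤1 pr
prime∤! pr (suc m) m<p p∣m! with euclidsLemma (suc m) (m !) pr p∣m!
... | inj₁ p∣1+m = <⇒≱ m<p (∣⇒≤ p∣1+m)
... | inj₂ p∣m!  = prime∤! pr m (<⇒≤ m<p) p∣m!

prime∣C : ∀ {p k} → Prime p → 0 < k → k < p → p ∣ p C k
prime∣C {p@(suc p-1)} {k@(suc k-1)} pr _ k<p
  with euclidsLemma (p C k) (k ! * (p ∸ k) !) pr (subst (p ∣_) (sym C*denominator≡p!) (m∣m*n (p-1 !)))
  where
  C*denominator≡p! : (p C k) * (k ! * (p ∸ k) !) ≡ p !
  C*denominator≡p! = trans (cong (_* (k ! * (p ∸ k) !)) (nCk≡n!/k![n-k]! (<⇒≤ k<p)))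
                           (m/n*n≡m {{k !* (p ∸ k) !≢0}} (k![n∸k]!∣n! (<⇒≤ k<p)))
... | inj₁ p∣C = p∣C
... | inj₂ p∣denominator with euclidsLemma (k !) ((p ∸ k) !) pr p∣denominator
...   | inj₁ p∣k!     = contradiction p∣k! (prime∤! pr k k<p)
...   | inj₂ p∣[p-k]! = contradiction p∣[p-k]! (prime∤! pr (p ∸ k) (s≤s (m∸n≤m p-1 k-1)))

freshman's-dream : ∀ {p} .{{_ : NonZero p}} → Prime p → ∀ a → (1 + a) ^ p % p ≡ (1 + a ^ p) % p
freshman's-dream {p@(suc p-1)} pr a = begin
  (1 + a) ^ p % p                                  ≡⟨ cong (_% p) (binomial-theorem a p) ⟩
  ∑ (suc p) term % p                               ≡⟨ cong (_% p) (∑-head p term) ⟩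
  (1 + (middle + term p)) % p                      ≡⟨ cong (λ t → (1 + (middle + t)) % p) last-term ⟩
  (1 + (middle + a ^ p)) % p                       ≡⟨ cong (λ m → (1 + (m + a ^ p)) % p) (m∣n⇒n≡quotient*m p∣middle) ⟩
  (1 + (c * p + a ^ p)) % p                        ≡⟨ cong (λ m → (1 + m) % p) (+-comm (c * p) (a ^ p)) ⟩
  (1 + (a ^ p + c * p)) % p                        ≡⟨ cong (_% p) (sym (+-assoc 1 (a ^ p) (c * p))) ⟩
  (1 + a ^ p + c * p) % p                          ≡⟨ [m+kn]%n≡m%n (1 + a ^ p) c p ⟩
  (1 + a ^ p) % p                                  ∎
  where
  open ≡-Reasoning
  term : ℕ → ℕ
  term i = (p C i) * a ^ i
  middle = ∑ p-1 (term ∘ suc)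
  p∣middle : p ∣ middle
  p∣middle = ∣-∑ p-1 (λ i i<p-1 → ∣m⇒∣m*n (a ^ suc i) (prime∣C pr (s≤s z≤n) (s≤s i<p-1)))
  c = quotient p∣middle
  last-term : term p ≡ a ^ p
  last-term = trans (cong (_* a ^ p) (nCn≡1 p)) (*-identityˡ (a ^ p))

fermat : ∀ {p} .{{_ : NonZero p}} → Prime p → ∀ a → a ^ p % p ≡ a % p
fermat {p@(suc _)} pr zero    = refl
fermat {p@(suc _)} pr (suc a) = begin
  (1 + a) ^ p % p                ≡⟨ freshman's-dream pr a ⟩
  (1 + a ^ p) % p                ≡⟨ %-distribˡ-+ 1 (a ^ p) p ⟩
  (1 % p + a ^ p % p) % p        ≡⟨ cong (λ r → (1 % p + r) % p) (fermat pr a) ⟩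
  (1 % p + a % p) % p            ≡⟨ sym (%-distribˡ-+ 1 a p) ⟩
  (1 + a) % p                    ∎
  where open ≡-Reasoning


-- Prime divisors of Φ₃(x) = x² + x + 1

[m+n]%r≡m%r⇒r∣n : ∀ m n r .{{_ : NonZero r}} → (m + n) % r ≡ m % r → r ∣ n
[m+n]%r≡m%r⇒r∣n m n r eq = ∣m+n∣m⇒∣n (divides ((m + n) / r) m/r*r+n≡[m+n]/r*r) (n∣m*n (m / r))
  where
  m/r*r+n≡[m+n]/r*r : m / r * r + n ≡ (m + n) / r * r
  m/r*r+n≡[m+n]/r*r = +-cancelˡ-≡ (m % r) _ _ (begin
    m % r + (m / r * r + n)       ≡⟨ sym (+-assoc (m % r) _ n) ⟩
    m % r + m / r * r + n         ≡⟨ cong (_+ n) (sym (m≡m%n+[m/n]*n m r)) ⟩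
    m + n                         ≡⟨ m≡m%n+[m/n]*n (m + n) r ⟩
    (m + n) % r + (m + n) / r * r ≡⟨ cong (_+ (m + n) / r * r) eq ⟩
    m % r + (m + n) / r * r       ∎)
    where open ≡-Reasoning

^-%-one : ∀ u r .{{_ : NonZero r}} → u % r ≡ 1 % r → ∀ m → u ^ m % r ≡ 1 % r
^-%-one u r u≡1 zero    = refl
^-%-one u r u≡1 (suc m) = begin
  u * u ^ m % r                   ≡⟨ %-distribˡ-* u (u ^ m) r ⟩
  (u % r) * (u ^ m % r) % r       ≡⟨ cong₂ (λ a b → a * b % r) u≡1 (^-%-one u r u≡1 m) ⟩
  (1 % r) * (1 % r) % r           ≡⟨ sym (%-distribˡ-* 1 1 r) ⟩
  1 % r                           ∎
  where open ≡-Reasoning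

^-%-exponent%3 : ∀ x r .{{_ : NonZero r}} → x ^ 3 % r ≡ 1 % r → ∀ e → x ^ e % r ≡ x ^ (e % 3) % r
^-%-exponent%3 x r x³≡1 e = begin
  x ^ e % r                                      ≡⟨ cong (λ e → x ^ e % r) (m≡m%n+[m/n]*n e 3) ⟩
  x ^ (e % 3 + c * 3) % r                        ≡⟨ cong (_% r) (^-distribˡ-+-* x (e % 3) (c * 3)) ⟩
  x ^ (e % 3) * x ^ (c * 3) % r                  ≡⟨ cong (λ t → x ^ (e % 3) * t % r) x^[c*3]≡[x³]^c ⟩
  x ^ (e % 3) * (x ^ 3) ^ c % r                  ≡⟨ %-distribˡ-* (x ^ (e % 3)) ((x ^ 3) ^ c) r ⟩
  (x ^ (e % 3) % r) * ((x ^ 3) ^ c % r) % r      ≡⟨ cong (λ t → (x ^ (e % 3) % r) * t % r) (^-%-one (x ^ 3) r x³≡1 c) ⟩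
  (x ^ (e % 3) % r) * (1 % r) % r                ≡⟨ sym (%-distribˡ-* (x ^ (e % 3)) 1 r) ⟩
  x ^ (e % 3) * 1 % r                            ≡⟨ cong (_% r) (*-identityʳ (x ^ (e % 3))) ⟩
  x ^ (e % 3) % r                                ∎
  where
  open ≡-Reasoning
  c = e / 3
  x^[c*3]≡[x³]^c : x ^ (c * 3) ≡ (x ^ 3) ^ c
  x^[c*3]≡[x³]^c = trans (cong (x ^_) (*-comm c 3)) (sym (^-*-assoc x 3 c))

Φ₃ : ℕ → ℕ
Φ₃ x = 1 + x + x * x

∣Φ₃⇒cube%≡1 : ∀ {r} .{{_ : NonZero r}} y → r ∣ Φ₃ (suc y) → suc y ^ 3 % r ≡ 1 % r
∣Φ₃⇒cube%≡1 {r} y r∣Φ₃[1+y] = begin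
  suc y ^ 3 % r                 ≡⟨ cong (_% r) (cube y) ⟩
  (1 + y * Φ₃ (suc y)) % r      ≡⟨ cong (λ t → (1 + y * t) % r) (m∣n⇒n≡quotient*m r∣Φ₃[1+y]) ⟩
  (1 + y * (c * r)) % r         ≡⟨ cong (λ t → (1 + t) % r) (sym (*-assoc y c r)) ⟩
  (1 + y * c * r) % r           ≡⟨ [m+kn]%n≡m%n 1 (y * c) r ⟩
  1 % r                         ∎
  where
  open ≡-Reasoning
  c = quotient r∣Φ₃[1+y]
  cube : ∀ y → (1 + y) * ((1 + y) * ((1 + y) * 1)) ≡ 1 + y * (1 + (1 + y) + (1 + y) * (1 + y))
  cube = solve-∀

-- If r ≡ 2 (mod 3) then x ^ r ≡ x² because x³ ≡ 1, while Fermat gives x ^ r ≡ x; so r ∣ x (x - 1),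
-- but r ∣ x would give r ∣ 1 and r ∣ x - 1 would give r ∣ 3.
prime∣Φ₃⇒%3≢2 : ∀ {r} x → Prime r → r ∣ Φ₃ x → r % 3 ≢ 2
prime∣Φ₃⇒%3≢2 zero pr r∣1 _ = prime∤1 pr r∣1
prime∣Φ₃⇒%3≢2 {r@(suc _)} x@(suc y) pr r∣Φ₃x r%3≡2 with euclidsLemma y x pr r∣y*x
  where
  x^r≡x² : x ^ r % r ≡ x ^ 2 % r
  x^r≡x² = trans (^-%-exponent%3 x r (∣Φ₃⇒cube%≡1 y r∣Φ₃x) r) (cong (λ e → x ^ e % r) r%3≡2)
  square : ∀ y → (1 + y) * ((1 + y) * 1) ≡ (1 + y) + y * (1 + y)
  square = solve-∀
  r∣y*x : r ∣ y * x
  r∣y*x = [m+n]%r≡m%r⇒r∣n x (y * x) r (trans (cong (_% r) (sym (square y))) (trans (sym x^r≡x²) (fermat pr x)))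
... | inj₂ r∣x = prime∤1 pr (∣m+n∣m⇒∣n (subst (r ∣_) (Φ₃≡ x) r∣Φ₃x) (∣m⇒∣m*n (1 + x) r∣x))
  where
  Φ₃≡ : ∀ x → 1 + x + x * x ≡ x * (1 + x) + 1
  Φ₃≡ = solve-∀
... | inj₁ r∣y
  with prime⇒irreducible prime[3] (∣m+n∣m⇒∣n (subst (r ∣_) (Φ₃≡ y) r∣Φ₃x) (∣m⇒∣m*n (3 + y) r∣y))
  where
  Φ₃≡ : ∀ y → 1 + (1 + y) + (1 + y) * (1 + y) ≡ y * (3 + y) + 3
  Φ₃≡ = solve-∀
...   | inj₁ r≡1 = <⇒≢ (prime>1 pr) (sym r≡1)
...   | inj₂ refl = 0≢1+n r%3≡2

prime∣Φ₃⇒≡3∨≡1[mod3] : ∀ {r} x → Prime r → r ∣ Φ₃ x → r ≡ 3 ⊎ r % 3 ≡ 1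
prime∣Φ₃⇒≡3∨≡1[mod3] {r} x pr r∣Φ₃x with r % 3 in r%3≡ | m%n<n r 3
... | 0 | _ = inj₁ (3∣prime⇒≡3 (m%n≡0⇒n∣m r 3 r%3≡))
  where
  3∣prime⇒≡3 : 3 ∣ r → r ≡ 3
  3∣prime⇒≡3 3∣r with prime⇒irreducible pr 3∣r
  ... | inj₂ 3≡r = sym 3≡r
... | 1 | _ = inj₂ refl
... | 2 | _ = contradiction r%3≡ (prime∣Φ₃⇒%3≢2 x pr r∣Φ₃x)
... | suc (suc (suc _)) | s≤s (s≤s (s≤s ()))

3∣Φ₃ : ∀ {p} → p % 3 ≡ 1 → 3 ∣ Φ₃ p
3∣Φ₃ {p} p%3≡1 = divides (1 + 3 * c + 3 * c * c) (trans (cong Φ₃ p≡1+c*3) (expand c))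
  where
  c = p / 3
  p≡1+c*3 : p ≡ 1 + c * 3
  p≡1+c*3 = trans (m≡m%n+[m/n]*n p 3) (cong (_+ c * 3) p%3≡1)
  expand : ∀ c → 1 + (1 + c * 3) + (1 + c * 3) * (1 + c * 3) ≡ (1 + 3 * c + 3 * c * c) * 3
  expand = solve-∀

prime∤Φ₃ : ∀ {p} → Prime p → ¬ p ∣ Φ₃ p
prime∤Φ₃ {p} pr p∣Φ₃p = prime∤1 pr (∣m+n∣m⇒∣n (subst (p ∣_) (regroup p) p∣Φ₃p) (m∣m*n (1 + p)))
  where
  regroup : ∀ p → 1 + p + p * p ≡ p * (1 + p) + 1
  regroup = solve-∀


-- Divisor sums

when : ∀ {A : Set} → Dec A → ℕ → ℕ
when (yes _) x = x
when (no _)  _ = 0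

unless : ∀ {A : Set} → Dec A → ℕ → ℕ
unless (yes _) _ = 0
unless (no _)  x = x

when-yes : ∀ {A : Set} (A? : Dec A) {x} → A → when A? x ≡ x
when-yes (yes _) _ = refl
when-yes (no ¬a) a = contradiction a ¬a

when-no : ∀ {A : Set} (A? : Dec A) {x} → ¬ A → when A? x ≡ 0
when-no (yes a) ¬a = contradiction a ¬a
when-no (no _)  _  = refl

when+unless : ∀ {A : Set} (A? : Dec A) x → when A? x + unless A? x ≡ x
when+unless (yes _) x = +-identityʳ x
when+unless (no _)  x = refl

sum-filter-applyUpTo : ∀ {P : Pred ℕ _} (P? : Decidable P) f n →
                       sum (filter P? (applyUpTo f n)) ≡ ∑ n (λ i → when (P? (f i)) (f i))
sum-filter-applyUpTo P? f zero    = refl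
sum-filter-applyUpTo P? f (suc n) = trans head (sym (∑-head n (λ i → when (P? (f i)) (f i))))
  where
  head : sum (filter P? (applyUpTo f (suc n))) ≡ when (P? (f 0)) (f 0) + ∑ n (λ i → when (P? (f (suc i))) (f (suc i)))
  head with P? (f 0)
  ... | yes _ = cong (f 0 +_) (sum-filter-applyUpTo P? (f ∘ suc) n)
  ... | no _  = sum-filter-applyUpTo P? (f ∘ suc) n

divisorTerm : ℕ → ℕ → ℕ
divisorTerm x d = when (d ∣? x) d

σ≡∑ : ∀ x → σ x ≡ ∑ x (divisorTerm x ∘ suc)
σ≡∑ x = trans (cong (sum ∘ filter (_∣? x)) (map-applyUpTo (λ i → i) suc x))
              (sum-filter-applyUpTo (_∣? x) suc x)

∑-multiples : ∀ p y (f : ℕ → ℕ) .{{_ : NonZero p}} →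
              ∑ (p * y) (λ i → when (p ∣? suc i) (f (suc i))) ≡ ∑ y (λ e → f (p * suc e))
∑-multiples p zero f rewrite *-zeroʳ p = refl
∑-multiples p@(suc p-1) (suc y) f = begin
  ∑ (p * suc y) g                                   ≡⟨ cong (λ k → ∑ k g) (trans (*-suc p y) (+-comm p (p * y))) ⟩
  ∑ (p * y + p) g                                   ≡⟨ ∑-split (p * y) p g ⟩
  ∑ (p * y) g + (∑ p-1 (g ∘ (p * y +_)) + g (p * y + p-1))
    ≡⟨ cong₂ (λ a b → ∑ (p * y) g + (a + b)) (∑-zero p-1 no-multiple) last-is-multiple ⟩
  ∑ (p * y) g + (0 + f (p * suc y))                 ≡⟨ cong (_+ f (p * suc y)) (∑-multiples p y f) ⟩
  ∑ (suc y) (λ e → f (p * suc e))                   ∎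
  where
  open ≡-Reasoning
  g : ℕ → ℕ
  g i = when (p ∣? suc i) (f (suc i))
  p*y+p≡p*[1+y] : p * y + p ≡ p * suc y
  p*y+p≡p*[1+y] = trans (+-comm (p * y) p) (sym (*-suc p y))
  no-multiple : ∀ j → j < p-1 → g (p * y + j) ≡ 0
  no-multiple j j<p-1 = when-no (p ∣? suc (p * y + j)) (λ p∣ →
    <⇒≱ (s≤s j<p-1) (∣⇒≤ (∣m+n∣m⇒∣n (subst (p ∣_) (sym (+-suc (p * y) j)) p∣) (m∣m*n y))))
  last-is-multiple : g (p * y + p-1) ≡ f (p * suc y)
  last-is-multiple = trans (when-yes (p ∣? suc (p * y + p-1)) p∣)
                           (cong f (trans (sym (+-suc (p * y) p-1)) p*y+p≡p*[1+y]))
    where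
    p∣ : p ∣ suc (p * y + p-1)
    p∣ = subst (p ∣_) (trans (sym p*y+p≡p*[1+y]) (+-suc (p * y) p-1)) (m∣m*n (suc y))

-- m is the part of p y coprime to p: divisors of p y divisible by p are p times the divisors of y,
-- and the others are exactly the divisors of m.
σ-split : ∀ p y m .{{_ : NonZero p}} .{{_ : NonZero y}} .{{_ : NonZero m}} →
          ¬ p ∣ m → m ∣ p * y → (∀ d → ¬ p ∣ d → d ∣ p * y → d ∣ m) →
          σ (p * y) ≡ σ m + p * σ y
σ-split p y m p∤m m∣py coprime-part = begin
  σ (p * y)                                 ≡⟨ σ≡∑ (p * y) ⟩
  ∑ (p * y) (D ∘ suc)                       ≡⟨ ∑-cong (p * y) (λ i _ → sym (when+unless (p ∣? suc i) (D (suc i)))) ⟩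
  ∑ (p * y) (λ i → multiple i + coprime i)  ≡⟨ ∑-distrib-+ (p * y) multiple coprime ⟩
  ∑ (p * y) multiple + ∑ (p * y) coprime    ≡⟨ +-comm (∑ (p * y) multiple) _ ⟩
  ∑ (p * y) coprime + ∑ (p * y) multiple    ≡⟨ cong₂ _+_ coprime-sum multiple-sum ⟩
  σ m + p * σ y                             ∎
  where
  open ≡-Reasoning
  D = divisorTerm (p * y)
  multiple coprime : ℕ → ℕ
  multiple i = when (p ∣? suc i) (D (suc i))
  coprime i = unless (p ∣? suc i) (D (suc i))
  multiple-sum : ∑ (p * y) multiple ≡ p * σ y
  multiple-sum = begin
    ∑ (p * y) multiple                     ≡⟨ ∑-multiples p y D ⟩
    ∑ y (λ e → D (p * suc e))              ≡⟨ ∑-cong y (λ e _ → scaled-term (suc e)) ⟩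
    ∑ y (λ e → p * divisorTerm y (suc e))  ≡⟨ ∑-distribˡ-* y p (divisorTerm y ∘ suc) ⟩
    p * ∑ y (divisorTerm y ∘ suc)          ≡⟨ cong (p *_) (sym (σ≡∑ y)) ⟩
    p * σ y                                ∎
    where
    scaled-term : ∀ e → D (p * e) ≡ p * divisorTerm y e
    scaled-term e with e ∣? y
    ... | yes e∣y = when-yes (p * e ∣? p * y) (*-monoʳ-∣ p e∣y)
    ... | no  e∤y = trans (when-no (p * e ∣? p * y) (e∤y ∘ *-cancelˡ-∣ p)) (sym (*-zeroʳ p))
  coprime-term : ∀ d → unless (p ∣? d) (D d) ≡ divisorTerm m d
  coprime-term d with p ∣? d | d ∣? m
  ... | yes p∣d | yes d∣m = contradiction (∣-trans p∣d d∣m) p∤m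
  ... | yes _   | no  _   = refl
  ... | no  p∤d | yes d∣m = when-yes (d ∣? p * y) (∣-trans d∣m m∣py)
  ... | no  p∤d | no  d∤m = when-no (d ∣? p * y) (d∤m ∘ coprime-part d p∤d)
  m≤py : m ≤ p * y
  m≤py = ∣⇒≤ {{m*n≢0 p y}} m∣py
  coprime-sum : ∑ (p * y) coprime ≡ σ m
  coprime-sum = begin
    ∑ (p * y) coprime                          ≡⟨ ∑-cong (p * y) (λ i _ → coprime-term (suc i)) ⟩
    ∑ (p * y) (divisorTerm m ∘ suc)            ≡⟨ cong (λ k → ∑ k (divisorTerm m ∘ suc)) (sym (m+[n∸m]≡n m≤py)) ⟩
    ∑ (m + (p * y ∸ m)) (divisorTerm m ∘ suc)  ≡⟨ ∑-split m (p * y ∸ m) (divisorTerm m ∘ suc) ⟩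
    ∑ m (divisorTerm m ∘ suc) + ∑ (p * y ∸ m) (λ i → divisorTerm m (suc (m + i)))
      ≡⟨ cong (∑ m (divisorTerm m ∘ suc) +_) (∑-zero (p * y ∸ m) (λ i _ → when-no (suc (m + i) ∣? m) (too-big i))) ⟩
    ∑ m (divisorTerm m ∘ suc) + 0              ≡⟨ +-identityʳ _ ⟩
    ∑ m (divisorTerm m ∘ suc)                  ≡⟨ sym (σ≡∑ m) ⟩
    σ m                                        ∎
    where
    too-big : ∀ i → ¬ suc (m + i) ∣ m
    too-big i d∣m = <⇒≱ (s≤s (m≤m+n m i)) (∣⇒≤ d∣m)

prime∤⇒coprime : ∀ {p d} → Prime p → ¬ p ∣ d → Coprime d p
prime∤⇒coprime pr p∤d (c∣d , c∣p) with prime⇒irreducible pr c∣p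
... | inj₁ c≡1 = c≡1
... | inj₂ refl = contradiction c∣d p∤d

coprime-∣-^* : ∀ {d p m} → Coprime d p → ∀ j → d ∣ p ^ j * m → d ∣ m
coprime-∣-^* {d} {m = m} _ zero d∣m = subst (d ∣_) (*-identityˡ m) d∣m
coprime-∣-^* {d} {p} {m} coprime (suc j) d∣ =
  coprime-∣-^* coprime j (coprime-divisor coprime (subst (d ∣_) (*-assoc p (p ^ j) m) d∣))

coprime-prime-power : ∀ {p s} → Prime p → ¬ p ∣ s → ∀ j → Coprime s (p ^ j)
coprime-prime-power {p} pr p∤s j {d} (d∣s , d∣p^j) =
  ∣1⇒≡1 (coprime-∣-^* (prime∤⇒coprime pr (λ p∣d → p∤s (∣-trans p∣d d∣s))) j
                      (subst (d ∣_) (sym (*-identityʳ (p ^ j))) d∣p^j))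

σ[p^1+j] : ∀ {p} → Prime p → ∀ j → σ (p ^ suc j) ≡ 1 + p * σ (p ^ j)
σ[p^1+j] {p} pr j = σ-split p (p ^ j) 1 (prime∤1 pr) (1∣ _) coprime-part
  where
  instance
    _ = prime⇒nonZero pr
    _ = m^n≢0 p j
  coprime-part : ∀ d → ¬ p ∣ d → d ∣ p ^ suc j → d ∣ 1
  coprime-part d p∤d d∣ = coprime-∣-^* (prime∤⇒coprime pr p∤d) (suc j) (subst (d ∣_) (sym (*-identityʳ _)) d∣)

σ-*-prime-power : ∀ {p m} → Prime p → ¬ p ∣ m → ∀ j → σ (p ^ j * m) ≡ σ (p ^ j) * σ m
σ-*-prime-power {m = m} pr p∤m zero = trans (cong σ (*-identityˡ m)) (sym (+-identityʳ (σ m)))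
σ-*-prime-power {p} {m} pr p∤m (suc j) = begin
  σ (p ^ suc j * m)               ≡⟨ cong σ (*-assoc p (p ^ j) m) ⟩
  σ (p * (p ^ j * m))             ≡⟨ σ-split p (p ^ j * m) m p∤m (∣n⇒∣m*n p (n∣m*n (p ^ j))) coprime-part ⟩
  σ m + p * σ (p ^ j * m)         ≡⟨ cong (λ s → σ m + p * s) (σ-*-prime-power pr p∤m j) ⟩
  σ m + p * (σ (p ^ j) * σ m)     ≡⟨ cong₂ _+_ (sym (*-identityˡ (σ m))) (sym (*-assoc p (σ (p ^ j)) (σ m))) ⟩
  1 * σ m + p * σ (p ^ j) * σ m   ≡⟨ sym (*-distribʳ-+ (σ m) 1 (p * σ (p ^ j))) ⟩
  (1 + p * σ (p ^ j)) * σ m       ≡⟨ cong (_* σ m) (sym (σ[p^1+j] pr j)) ⟩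
  σ (p ^ suc j) * σ m             ∎
  where
  open ≡-Reasoning
  instance
    _ = prime⇒nonZero pr
    _ = ≢-nonZero {m} λ { refl → p∤m (_ ∣0) }
    _ = m*n≢0 (p ^ j) m {{m^n≢0 p j}}
  coprime-part : ∀ d → ¬ p ∣ d → d ∣ p * (p ^ j * m) → d ∣ m
  coprime-part d p∤d d∣ =
    coprime-∣-^* (prime∤⇒coprime pr p∤d) (suc j) (subst (d ∣_) (sym (*-assoc p (p ^ j) m)) d∣)

σ[p²] : ∀ {p} → Prime p → σ (p ^ 2) ≡ Φ₃ p
σ[p²] {p} pr = begin
  σ (p ^ 2)                    ≡⟨ σ[p^1+j] pr 1 ⟩
  1 + p * σ (p ^ 1)            ≡⟨ cong (λ x → 1 + p * x) (σ[p^1+j] pr 0) ⟩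
  1 + p * (1 + p * 1)          ≡⟨ expand p ⟩
  Φ₃ p                         ∎
  where
  open ≡-Reasoning
  expand : ∀ p → 1 + p * (1 + p * 1) ≡ 1 + p + p * p
  expand = solve-∀

prime∤σ[p^j] : ∀ {p} → Prime p → ∀ j → ¬ p ∣ σ (p ^ j)
prime∤σ[p^j] pr zero    = prime∤1 pr
prime∤σ[p^j] {p} pr (suc j) p∣σ =
  prime∤1 pr (∣m+n∣m⇒∣n (subst (p ∣_) (trans (σ[p^1+j] pr j) (+-comm 1 _)) p∣σ) (m∣m*n (σ (p ^ j))))

σ[p^j]%m : ∀ {p} m .{{_ : NonZero m}} → Prime p → p % m ≡ 1 % m → ∀ j → σ (p ^ j) % m ≡ suc j % m
σ[p^j]%m m pr p≡1 zero    = refl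
σ[p^j]%m {p} m pr p≡1 (suc j) = begin
  σ (p ^ suc j) % m                                ≡⟨ cong (_% m) (σ[p^1+j] pr j) ⟩
  (1 + p * σ (p ^ j)) % m                          ≡⟨ %-distribˡ-+ 1 (p * σ (p ^ j)) m ⟩
  (1 % m + p * σ (p ^ j) % m) % m                  ≡⟨ cong (λ x → (1 % m + x) % m) (%-distribˡ-* p (σ (p ^ j)) m) ⟩
  (1 % m + (p % m) * (σ (p ^ j) % m) % m) % m
    ≡⟨ cong₂ (λ x y → (1 % m + x * y % m) % m) p≡1 (σ[p^j]%m m pr p≡1 j) ⟩
  (1 % m + (1 % m) * (suc j % m) % m) % m          ≡⟨ cong (λ x → (1 % m + x) % m) (sym (%-distribˡ-* 1 (suc j) m)) ⟩
  (1 % m + (1 * suc j) % m) % m                    ≡⟨ cong (λ x → (1 % m + x % m) % m) (*-identityˡ (suc j)) ⟩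
  (1 % m + suc j % m) % m                          ≡⟨ sym (%-distribˡ-+ 1 (suc j) m) ⟩
  suc (suc j) % m                                  ∎
  where open ≡-Reasoning


-- Squarefree numbers

squarefree⇒nonZero : ∀ {n} → Squarefree n → NonZero n
squarefree⇒nonZero {zero}  sqf = contradiction (sqf 2 (4 ∣0)) λ ()
squarefree⇒nonZero {suc n} sqf = _

squarefree-∣ : ∀ {m n} → m ∣ n → Squarefree n → Squarefree m
squarefree-∣ m∣n sqf d d²∣m = sqf d (∣-trans d²∣m m∣n)

squarefree⇒prime∤cofactor : ∀ {p m} → Prime p → Squarefree (p * m) → ¬ p ∣ m
squarefree⇒prime∤cofactor {p} pr sqf p∣m = <⇒≢ (prime>1 pr) (sym (sqf p (*-monoʳ-∣ p p∣m)))

∃prime∣ : ∀ {m} → 1 < m → ∃[ p ] Prime p × p ∣ m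
∃prime∣ {m@(suc _)} 1<m = from-factorisation (factorise m)
  where
  from-factorisation : PrimeFactorisation m → ∃[ p ] Prime p × p ∣ m
  from-factorisation record { factors = [] ; isFactorisation = m≡1 } = contradiction (sym m≡1) (<⇒≢ 1<m)
  from-factorisation record { factors = p ∷ ps ; isFactorisation = m≡ ; factorsPrime = pr ∷ _ } =
    p , pr , subst (p ∣_) (sym m≡) (m∣m*n (product ps))

-- With g = gcd s n, s = g a and n = g b for coprime a, b; then g a ∣ g² b² gives a ∣ g, hence a² ∣ s.
squarefree∣square⇒∣ : ∀ {s n} → Squarefree s → s ∣ n * n → s ∣ n
squarefree∣square⇒∣ {s} {zero}  _   _     = s ∣0
squarefree∣square⇒∣ {s} {n@(suc _)} sqf s∣n² = subst (_∣ n) (sym s≡g) (gcd[m,n]∣n s n)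
  where
  g = gcd s n
  instance _ = ≢-nonZero (gcd[m,n]≢0 s n (inj₂ λ ()))
  a = s / g
  b = n / g
  s≡g*a : s ≡ g * a
  s≡g*a = sym (m*[n/m]≡n (gcd[m,n]∣m s n))
  n≡g*b : n ≡ g * b
  n≡g*b = sym (m*[n/m]≡n (gcd[m,n]∣n s n))
  a∣g*b*b : a ∣ b * (g * b)
  a∣g*b*b = *-cancelˡ-∣ g (subst₂ _∣_ s≡g*a n²≡ s∣n²)
    where
    n²≡ : n * n ≡ g * (b * (g * b))
    n²≡ = trans (cong₂ _*_ n≡g*b n≡g*b) (*-assoc g b (g * b))
  a∣g : a ∣ g
  a∣g = coprime-divisor (coprime-/gcd s n) (subst (a ∣_) (*-comm g b) (coprime-divisor (coprime-/gcd s n) a∣g*b*b))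
  s≡g : s ≡ g
  s≡g = trans s≡g*a (trans (cong (g *_) (sqf a (subst (a * a ∣_) (sym s≡g*a) (*-monoˡ-∣ a a∣g)))) (*-identityʳ g))

squarefree*squarefree≡square : ∀ {s t n} → Squarefree s → Squarefree t → n * n ≡ s * t → s ≡ n × t ≡ n
squarefree*squarefree≡square {s} {t} {n} s-sqf t-sqf n²≡s*t = s≡n , t≡n
  where
  instance
    _ = squarefree⇒nonZero s-sqf
    _ = squarefree⇒nonZero t-sqf
    _ = ≢-nonZero {n} λ { refl → ≢-nonZero⁻¹ (s * t) {{m*n≢0 s t}} (sym n²≡s*t) }
  s≤n : s ≤ n
  s≤n = ∣⇒≤ (squarefree∣square⇒∣ s-sqf (subst (s ∣_) (sym n²≡s*t) (m∣m*n t)))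
  t≤n : t ≤ n
  t≤n = ∣⇒≤ (squarefree∣square⇒∣ t-sqf (subst (t ∣_) (sym n²≡s*t) (n∣m*n s)))
  s≮n : ¬ s < n
  s≮n s<n = <⇒≢ (≤-<-trans (*-monoʳ-≤ s t≤n) (*-monoˡ-< n s<n)) (sym n²≡s*t)
  s≡n : s ≡ n
  s≡n = ≤∧≮⇒≡ s≤n s≮n
  t≡n : t ≡ n
  t≡n = *-cancelˡ-≡ t n n (trans (cong (_* t) (sym s≡n)) (sym n²≡s*t))

coprime-cofactor : ∀ {s Q B M} .{{_ : NonZero s}} → Coprime s Q → s * B ≡ Q * M → ∃[ t ] M ≡ s * t × B ≡ Q * t
coprime-cofactor {s} {Q} {B} {M} coprime s*B≡Q*M = t , M≡s*t , *-cancelˡ-≡ B (Q * t) s s*B≡s*Q*t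
  where
  s∣M : s ∣ M
  s∣M = coprime-divisor coprime (subst (s ∣_) s*B≡Q*M (m∣m*n B))
  t = quotient s∣M
  M≡s*t = m∣n⇒n≡m*quotient s∣M
  s*B≡s*Q*t : s * B ≡ s * (Q * t)
  s*B≡s*Q*t = trans s*B≡Q*M (trans (cong (Q *_) M≡s*t) (x∙yz≈y∙xz Q s t))

gcd[s*t,Q*t]≡t : ∀ {s Q} t → Coprime s Q → gcd (s * t) (Q * t) ≡ t
gcd[s*t,Q*t]≡t {s} {Q} t coprime = begin
  gcd (s * t) (Q * t)    ≡⟨ cong₂ gcd (*-comm s t) (*-comm Q t) ⟩
  gcd (t * s) (t * Q)    ≡⟨ sym (c*gcd[m,n]≡gcd[cm,cn] t s Q) ⟩
  t * gcd s Q            ≡⟨ cong (t *_) (coprime⇒gcd≡1 coprime) ⟩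
  t * 1                  ≡⟨ *-identityʳ t ⟩
  t                      ∎
  where open ≡-Reasoning

-- With n² = s t and B = Q t, the gcd of n² and B is t; two squarefree factors of n² must both be n.
squarefree-cofactors : ∀ {s Q B n} → Coprime s Q → s * B ≡ Q * (n * n) →
                       Squarefree (gcd (n * n) B) → Squarefree s → s ≡ n × B ≡ Q * n
squarefree-cofactors {s} {Q} {B} {n} coprime s*B≡Q*n² H-sqf s-sqf = s≡n , trans B≡Q*t (cong (Q *_) t≡n)
  where
  instance _ = squarefree⇒nonZero s-sqf
  cofactor = coprime-cofactor coprime s*B≡Q*n²
  t = proj₁ cofactor
  n²≡s*t = proj₁ (proj₂ cofactor)
  B≡Q*t = proj₂ (proj₂ cofactor)
  H≡t : gcd (n * n) B ≡ t
  H≡t = trans (cong₂ gcd n²≡s*t B≡Q*t) (gcd[s*t,Q*t]≡t t coprime)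
  s≡n×t≡n = squarefree*squarefree≡square s-sqf (subst Squarefree H≡t H-sqf) n²≡s*t
  s≡n = proj₁ s≡n×t≡n
  t≡n = proj₂ s≡n×t≡n


-- σ(n²) for squarefree n

σ[[p*m]²] : ∀ {p m} → Prime p → Squarefree (p * m) → σ ((p * m) * (p * m)) ≡ Φ₃ p * σ (m * m)
σ[[p*m]²] {p} {m} pr sqf = begin
  σ ((p * m) * (p * m))        ≡⟨ cong σ (regroup p m) ⟩
  σ (p ^ 2 * (m * m))          ≡⟨ σ-*-prime-power pr p∤m² 2 ⟩
  σ (p ^ 2) * σ (m * m)        ≡⟨ cong (_* σ (m * m)) (σ[p²] pr) ⟩
  Φ₃ p * σ (m * m)             ∎
  where
  open ≡-Reasoning
  regroup : ∀ p m → (p * m) * (p * m) ≡ p * (p * 1) * (m * m)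
  regroup = solve-∀
  p∤m : ¬ p ∣ m
  p∤m = squarefree⇒prime∤cofactor pr sqf
  p∤m² : ¬ p ∣ m * m
  p∤m² p∣m² with euclidsLemma m m pr p∣m²
  ... | inj₁ p∣m = p∤m p∣m
  ... | inj₂ p∣m = p∤m p∣m

prime∣σ[n²]⇒∣Φ₃ : ∀ {r} n → Squarefree n → Prime r → r ∣ σ (n * n) →
                  ∃[ p ] Prime p × p ∣ n × r ∣ Φ₃ p
prime∣σ[n²]⇒∣Φ₃ {r} = <-rec P step
  where
  P : ℕ → Set
  P n = Squarefree n → Prime r → r ∣ σ (n * n) → ∃[ p ] Prime p × p ∣ n × r ∣ Φ₃ p
  step : ∀ n → (∀ {m} → m < n → P m) → P n
  step n rec n-sqf r-pr r∣σ[n²] with n ≟ 1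
  ... | yes refl = contradiction r∣σ[n²] (prime∤1 r-pr)
  ... | no  n≢1 with ∃prime∣ (≤∧≢⇒< (>-nonZero⁻¹ n {{squarefree⇒nonZero n-sqf}}) (n≢1 ∘ sym))
  ...   | p , p-pr , p∣n with euclidsLemma (Φ₃ p) (σ (m * m)) r-pr (subst (r ∣_) σ[n²]≡ r∣σ[n²])
    where
    m = quotient p∣n
    σ[n²]≡ : σ (n * n) ≡ Φ₃ p * σ (m * m)
    σ[n²]≡ = trans (cong (λ x → σ (x * x)) (m∣n⇒n≡m*quotient p∣n))
                   (σ[[p*m]²] p-pr (subst Squarefree (m∣n⇒n≡m*quotient p∣n) n-sqf))
  ...     | inj₁ r∣Φ₃p = p , p-pr , p∣n , r∣Φ₃p
  ...     | inj₂ r∣σ[m²] with rec m<n (squarefree-∣ (quotient-∣ p∣n) n-sqf) r-pr r∣σ[m²]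
    where
    m = quotient p∣n
    instance _ = squarefree⇒nonZero (squarefree-∣ (quotient-∣ p∣n) n-sqf)
    m<n : m < n
    m<n = subst (m <_) (trans (*-comm m p) (sym (m∣n⇒n≡m*quotient p∣n))) (m<m*n m p (prime>1 p-pr))
  ...       | p′ , p′-pr , p′∣m , r∣Φ₃p′ = p′ , p′-pr , ∣-trans p′∣m (quotient-∣ p∣n) , r∣Φ₃p′

prime[13] : Prime 13
prime[13] = from-yes (prime? 13)

3∤13 : ¬ 3 ∣ 13
3∤13 = from-no (3 ∣? 13)

13*Φ₃[p]≡3*Q*p⇒p≡13 : ∀ {p Q} → Prime p → 13 * Φ₃ p ≡ 3 * (Q * p) → p ≡ 13 × Q ≡ 61
13*Φ₃[p]≡3*Q*p⇒p≡13 {p} {Q} p-pr eq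
  with euclidsLemma 13 (Φ₃ p) p-pr (subst (p ∣_) (sym eq) (∣n⇒∣m*n 3 (n∣m*n Q)))
... | inj₂ p∣Φ₃p = contradiction p∣Φ₃p (prime∤Φ₃ p-pr)
... | inj₁ p∣13 with prime⇒irreducible prime[13] p∣13
...   | inj₁ refl = contradiction p-pr λ ()
...   | inj₂ refl = refl , *-cancelʳ-≡ Q 61 39 (trans (regroup Q) (sym eq))
  where
  regroup : ∀ Q → Q * 39 ≡ 3 * (Q * 13)
  regroup = solve-∀

PrimePeeling : ℕ → Set
PrimePeeling d = ∃[ p ] ∃[ d′ ] Prime p × d ≡ p * d′ × 3 ∣ Φ₃ p × σ (d * d) ≡ Φ₃ p * σ (d′ * d′)

module _ {n Q : ℕ} (n-sqf : Squarefree n) (σ[n²]≡Q*n : σ (n * n) ≡ Q * n) (3∤Q : ¬ 3 ∣ Q) where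

  prime∣n⇒≡3∨≡1[mod3] : ∀ {r} → Prime r → r ∣ n → r ≡ 3 ⊎ r % 3 ≡ 1
  prime∣n⇒≡3∨≡1[mod3] {r} r-pr r∣n
    with prime∣σ[n²]⇒∣Φ₃ n n-sqf r-pr (subst (r ∣_) (sym σ[n²]≡Q*n) (∣n⇒∣m*n Q r∣n))
  ... | p , _ , _ , r∣Φ₃p = prime∣Φ₃⇒≡3∨≡1[mod3] p r-pr r∣Φ₃p

  -- A prime factor p ≢ 3 of n satisfies p ≡ 1 (mod 3), so σ((p d′)²) = Φ₃(p) σ(d′²) gains a factor 3.
  peel : ∀ {d} → d ∣ n → ¬ 3 ∣ d → d ≢ 1 → PrimePeeling d
  peel {d} d∣n 3∤d d≢1 with ∃prime∣ (≤∧≢⇒< (>-nonZero⁻¹ d {{squarefree⇒nonZero d-sqf}}) (d≢1 ∘ sym))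
    where d-sqf = squarefree-∣ d∣n n-sqf
  ... | p , p-pr , p∣d with prime∣n⇒≡3∨≡1[mod3] p-pr (∣-trans p∣d d∣n)
  ...   | inj₁ refl   = contradiction p∣d 3∤d
  ...   | inj₂ p%3≡1 = p , quotient p∣d , p-pr , d≡p*d′ , 3∣Φ₃ {p} p%3≡1 , σ[d²]≡
    where
    d≡p*d′ = m∣n⇒n≡m*quotient p∣d
    σ[d²]≡ = trans (cong (λ x → σ (x * x)) d≡p*d′)
                   (σ[[p*m]²] p-pr (subst Squarefree d≡p*d′ (squarefree-∣ d∣n n-sqf)))

  3∤Q*d : ∀ {d} → ¬ 3 ∣ d → ¬ 3 ∣ Q * d
  3∤Q*d 3∤d 3∣Q*d with euclidsLemma Q _ prime[3] 3∣Q*d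
  ... | inj₁ 3∣Q = 3∤Q 3∣Q
  ... | inj₂ 3∣d = 3∤d 3∣d

  3∤n⇒n≡1 : ¬ 3 ∣ n → n ≡ 1 × Q ≡ 1
  3∤n⇒n≡1 3∤n with n ≟ 1
  ... | yes refl = refl , trans (sym (*-identityʳ Q)) (sym σ[n²]≡Q*n)
  ... | no  n≢1 with peel ∣-refl 3∤n n≢1
  ...   | _ , n′ , _ , _ , 3∣Φ₃p , σ[n²]≡ =
          contradiction (subst (3 ∣_) (trans (sym σ[n²]≡) σ[n²]≡Q*n) (∣m⇒∣m*n (σ (n′ * n′)) 3∣Φ₃p)) (3∤Q*d 3∤n)

  module _ {m} (n≡3*m : n ≡ 3 * m) where

    m∣n : m ∣ n
    m∣n = subst (m ∣_) (sym n≡3*m) (n∣m*n 3)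

    3∤m : ¬ 3 ∣ m
    3∤m = squarefree⇒prime∤cofactor prime[3] (subst Squarefree n≡3*m n-sqf)

    13*σ[m²]≡3*[Q*m] : 13 * σ (m * m) ≡ 3 * (Q * m)
    13*σ[m²]≡3*[Q*m] = begin
      13 * σ (m * m)          ≡⟨ sym (σ[[p*m]²] {m = m} prime[3] (subst Squarefree n≡3*m n-sqf)) ⟩
      σ ((3 * m) * (3 * m))   ≡⟨ cong (λ x → σ (x * x)) (sym n≡3*m) ⟩
      σ (n * n)               ≡⟨ σ[n²]≡Q*n ⟩
      Q * n                   ≡⟨ cong (Q *_) n≡3*m ⟩
      Q * (3 * m)             ≡⟨ x∙yz≈y∙xz Q 3 m ⟩
      3 * (Q * m)             ∎
      where open ≡-Reasoning

    3∣σ[m²] : 3 ∣ σ (m * m)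
    3∣σ[m²] = [ (λ 3∣13 → contradiction 3∣13 3∤13) , id ]′
                (euclidsLemma 13 (σ (m * m)) prime[3] (subst (3 ∣_) (sym 13*σ[m²]≡3*[Q*m]) (m∣m*n (Q * m))))

    m≢1 : m ≢ 1
    m≢1 m≡1 = prime∤1 prime[3] (subst (λ x → 3 ∣ σ (x * x)) m≡1 3∣σ[m²])

    -- A second prime factor of m would make 9 ∣ σ(m²) = 3 Q m / 13, so m is a prime.
    m≡p*m′⇒n≡39 : ∀ {p m′} → Prime p → m ≡ p * m′ → 3 ∣ Φ₃ p → σ (m * m) ≡ Φ₃ p * σ (m′ * m′) →
                  n ≡ 39 × Q ≡ 61
    m≡p*m′⇒n≡39 {p} {m′} p-pr m≡p*m′ 3∣Φ₃p σ[m²]≡ with m′ ≟ 1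
    ... | yes refl = map₁ (λ p≡13 → trans n≡3*m (cong (3 *_) (trans m≡p p≡13)))
                          (13*Φ₃[p]≡3*Q*p⇒p≡13 p-pr (begin
                            13 * Φ₃ p          ≡⟨ cong (13 *_) (sym (trans σ[m²]≡ (*-identityʳ (Φ₃ p)))) ⟩
                            13 * σ (m * m)     ≡⟨ 13*σ[m²]≡3*[Q*m] ⟩
                            3 * (Q * m)        ≡⟨ cong (λ x → 3 * (Q * x)) m≡p ⟩
                            3 * (Q * p)        ∎))
      where
      open ≡-Reasoning
      m≡p : m ≡ p
      m≡p = trans m≡p*m′ (*-identityʳ p)
    ... | no  m′≢1 = contradiction (3∣Q*m (peel (∣-trans m′∣m m∣n) 3∤m′ m′≢1)) (3∤Q*d 3∤m)
      where
      m′∣m : m′ ∣ m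
      m′∣m = subst (m′ ∣_) (sym m≡p*m′) (n∣m*n p)
      3∤m′ : ¬ 3 ∣ m′
      3∤m′ 3∣m′ = 3∤m (∣-trans 3∣m′ m′∣m)
      3∣Q*m : PrimePeeling m′ → 3 ∣ Q * m
      3∣Q*m (_ , m″ , _ , _ , 3∣Φ₃p′ , σ[m′²]≡) =
        *-cancelˡ-∣ 3 (subst (3 * 3 ∣_) 13*σ[m²]≡3*[Q*m] (∣n⇒∣m*n 13 9∣σ[m²]))
        where
        3∣σ[m′²] : 3 ∣ σ (m′ * m′)
        3∣σ[m′²] = subst (3 ∣_) (sym σ[m′²]≡) (∣m⇒∣m*n (σ (m″ * m″)) 3∣Φ₃p′)
        9∣σ[m²] : 3 * 3 ∣ σ (m * m)
        9∣σ[m²] = subst (3 * 3 ∣_) (sym σ[m²]≡) (*-pres-∣ 3∣Φ₃p 3∣σ[m′²])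

    n≡3*m⇒n≡39 : n ≡ 39 × Q ≡ 61
    n≡3*m⇒n≡39 = let (_ , _ , p-pr , m≡p*m′ , 3∣Φ₃p , σ[m²]≡) = peel m∣n 3∤m m≢1
                 in m≡p*m′⇒n≡39 p-pr m≡p*m′ 3∣Φ₃p σ[m²]≡

  σ[n²]≡Q*n-solutions : (n ≡ 1 × Q ≡ 1) ⊎ (n ≡ 39 × Q ≡ 61)
  σ[n²]≡Q*n-solutions with 3 ∣? n
  ... | no  3∤n = inj₁ (3∤n⇒n≡1 3∤n)
  ... | yes 3∣n = inj₂ (n≡3*m⇒n≡39 {quotient 3∣n} (m∣n⇒n≡m*quotient 3∣n))


-- Odd perfect numbers in Eulerian form

2∣σ[q^k] : ∀ {q k} → Prime q → q % 4 ≡ 1 → k % 4 ≡ 1 → 2 ∣ σ (q ^ k)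
2∣σ[q^k] {q} {k} pr q%4≡1 k%4≡1 = m%n≡0⇒n∣m (σ (q ^ k)) 2 (begin
  σ (q ^ k) % 2         ≡⟨ sym (m∣n⇒o%n%m≡o%m 2 4 (σ (q ^ k)) (divides 2 refl)) ⟩
  σ (q ^ k) % 4 % 2     ≡⟨ cong (_% 2) (σ[p^j]%m 4 pr q%4≡1 k) ⟩
  suc k % 4 % 2         ≡⟨ cong (_% 2) (%-distribˡ-+ 1 k 4) ⟩
  (1 + k % 4) % 4 % 2   ≡⟨ cong (λ x → (1 + x) % 4 % 2) k%4≡1 ⟩
  0                     ∎)
  where open ≡-Reasoning

prime-power≢1 : ∀ {p k} → Prime p → 0 < k → p ^ k ≢ 1
prime-power≢1 {p} {k} pr 0<k p^k≡1 with m^n≡1⇒n≡0∨m≡1 p k p^k≡1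
... | inj₁ k≡0 = <⇒≢ 0<k (sym k≡0)
... | inj₂ p≡1 = <⇒≢ (prime>1 pr) (sym p≡1)

3∤prime-power : ∀ {p} → Prime p → p ≢ 3 → ∀ k → ¬ 3 ∣ p ^ k
3∤prime-power {p} pr p≢3 k 3∣p^k = contradiction (coprime-prime-power pr p∤3 k (∣-refl , 3∣p^k)) λ ()
  where
  p∤3 : ¬ p ∣ 3
  p∤3 p∣3 with prime⇒irreducible prime[3] p∣3
  ... | inj₁ p≡1 = <⇒≢ (prime>1 pr) (sym p≡1)
  ... | inj₂ p≡3 = p≢3 p≡3

half-σ[p^k]*σ[m]≡p^k*m : ∀ {p k m} → Prime p → ¬ p ∣ m → 2 ∣ σ (p ^ k) → Perfect (p ^ k * m) →
                         σ (p ^ k) / 2 * σ m ≡ p ^ k * m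
half-σ[p^k]*σ[m]≡p^k*m {p} {k} {m} pr p∤m 2∣σ perfect = *-cancelˡ-≡ _ _ 2 (begin
  2 * (s * σ m)        ≡⟨ x∙yz≈y∙xz 2 s (σ m) ⟩
  s * (2 * σ m)        ≡⟨ sym (*-assoc s 2 (σ m)) ⟩
  s * 2 * σ m          ≡⟨ cong (_* σ m) (m/n*n≡m 2∣σ) ⟩
  σ (p ^ k) * σ m      ≡⟨ sym (σ-*-prime-power pr p∤m k) ⟩
  σ (p ^ k * m)        ≡⟨ perfect ⟩
  2 * (p ^ k * m)      ∎)
  where
  open ≡-Reasoning
  s = σ (p ^ k) / 2

corollary1 : (N q k n : ℕ) → ¬ (2 ∣ N) → Perfect N → Prime q → 0 < k → 0 < n →
    q % 4 ≡ 1 → k % 4 ≡ 1 → gcd q n ≡ 1 → N ≡ q ^ k * (n * n) →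
    Squarefree (gcd (n * n) (σ (n * n))) → ¬ Squarefree (σ (q ^ k) / 2)
corollary1 N q k n _ perfect q-prime 0<k _ q%4≡1 k%4≡1 gcd[q,n]≡1 refl H-sqf s-sqf =
  [ prime-power≢1 q-prime 0<k ∘ proj₂ , σ[61]≢78 ]′
    (σ[n²]≡Q*n-solutions (subst Squarefree s≡n s-sqf) σ[n²]≡Q*n (3∤prime-power q-prime q≢3 k))
  where
  Q = q ^ k
  s = σ Q / 2
  2∣σ[Q] = 2∣σ[q^k] {k = k} q-prime q%4≡1 k%4≡1
  q∤n : ¬ q ∣ n
  q∤n q∣n = prime∤1 q-prime (subst (q ∣_) gcd[q,n]≡1 (gcd-greatest ∣-refl q∣n))
  q∤n² : ¬ q ∣ n * n
  q∤n² q∣n² = [ q∤n , q∤n ]′ (euclidsLemma n n q-prime q∣n²)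
  q∤s : ¬ q ∣ s
  q∤s q∣s = prime∤σ[p^j] q-prime k (∣-trans q∣s (m/n∣m 2∣σ[Q]))
  s≡n×σ[n²]≡Q*n = squarefree-cofactors (coprime-prime-power q-prime q∤s k)
                    (half-σ[p^k]*σ[m]≡p^k*m {k = k} q-prime q∤n² 2∣σ[Q] perfect) H-sqf s-sqf
  s≡n = proj₁ s≡n×σ[n²]≡Q*n
  σ[n²]≡Q*n = proj₂ s≡n×σ[n²]≡Q*n
  q≢3 : q ≢ 3
  q≢3 q≡3 = contradiction (trans (cong (_% 4) (sym q≡3)) q%4≡1) λ ()
  σ[61]≢78 : ¬ (n ≡ 39 × Q ≡ 61)
  σ[61]≢78 (n≡39 , Q≡61) =
    contradiction (trans (cong σ (sym Q≡61)) (trans (sym (m/n*n≡m 2∣σ[Q])) (cong (_* 2) (trans s≡n n≡39)))) λ ()
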